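{- Let $x$ be any cycle structure of an element of $S_\infty$. There exists $b\in\mathbb{N}$ such that every metacyclic subgroup $D$ of $S_\infty$ (equivalently, every metacyclic group embedded in $S_\infty$) contains at most $b$ elements with cycle structure $x$.
   Context: $S_\infty$ is the group of permutations of $\mathbb{N}$ fixing all but finitely many elements. The cycle structure of $\sigma\in S_\infty$ is the non-increasing sequence of lengths of the disjoint cycles of $\sigma$. A group is metacyclic if it has a cyclic normal subgroup with cyclic quotient. -}

module Defs where

open import Level using (0ℓ)
open import Data.Nat using (ℕ; zero; suc; _≤_; _⊔_; _≡ᵇ_; _/_)
open import Data.Nat.Properties using (≤-trans; m≤m⊔n; m≤n⊔m)
open import Data.Integer using (ℤ; +_; -[1+_])
open import Data.Bool using (if_then_else_)
open import Data.List using (List; []; _∷_; _++_; length; filter; upTo; replicate)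
open import Data.Product using (Σ; ∃; ∃-syntax; _×_; _,_)
open import Relation.Nullary using (¬_)
open import Relation.Unary using (Pred)
open import Relation.Binary.PropositionalEquality using (_≡_; refl; sym; trans; cong)
open import Function using (_∘_; id)
import Data.Nat as ℕ

-- S∞ : permutations of ℕ fixing all but finitely many points.

record Perm∞ : Set where
  field
    fun     : ℕ → ℕ
    inv     : ℕ → ℕ
    inv-fun : ∀ i → inv (fun i) ≡ i
    fun-inv : ∀ i → fun (inv i) ≡ i
    bound   : ℕ
    fixes   : ∀ i → bound ≤ i → fun i ≡ i
open Perm∞ public

infix 4 _≈_
_≈_ : Perm∞ → Perm∞ → Set
σ ≈ τ = ∀ i → fun σ i ≡ fun τ i

idP : Perm∞
idP = record { fun = id ; inv = id ; inv-fun = λ _ → refl ; fun-inv = λ _ → refl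
             ; bound = 0 ; fixes = λ _ _ → refl }

infixl 7 _∙_
_∙_ : Perm∞ → Perm∞ → Perm∞
σ ∙ τ = record
  { fun = fun σ ∘ fun τ
  ; inv = inv τ ∘ inv σ
  ; inv-fun = λ i → trans (cong (inv τ) (inv-fun σ (fun τ i))) (inv-fun τ i)
  ; fun-inv = λ i → trans (cong (fun σ) (fun-inv τ (inv σ i))) (fun-inv σ i)
  ; bound = bound σ ⊔ bound τ
  ; fixes = λ i b≤i →
      trans (cong (fun σ) (fixes τ i (≤-trans (m≤n⊔m (bound σ) (bound τ)) b≤i)))
            (fixes σ i (≤-trans (m≤m⊔n (bound σ) (bound τ)) b≤i))
  }

_⁻¹ : Perm∞ → Perm∞
σ ⁻¹ = record
  { fun = inv σ ; inv = fun σ ; inv-fun = fun-inv σ ; fun-inv = inv-fun σ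
  ; bound = bound σ
  ; fixes = λ i b≤i → trans (cong (inv σ) (sym (fixes σ i b≤i))) (inv-fun σ i)
  }

_^ⁿ_ : Perm∞ → ℕ → Perm∞
σ ^ⁿ zero  = idP
σ ^ⁿ suc n = σ ∙ (σ ^ⁿ n)

_^_ : Perm∞ → ℤ → Perm∞
σ ^ (+ n)      = σ ^ⁿ n
σ ^ (-[1+ n ]) = (σ ⁻¹) ^ⁿ suc n

-- Cycle structure.
-- For σ with bound n, σ permutes {0,…,n-1}; the length of the cycle
-- through i is the least k ∈ {1,…,n} with σᵏ(i) = i.

iter : (ℕ → ℕ) → ℕ → ℕ → ℕ
iter f zero    i = i
iter f (suc k) i = f (iter f k i)

-- least k in {k₀, …, k₀+fuel-1} with fᵏ(i) = i (0 if none)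
search : (ℕ → ℕ) → ℕ → ℕ → ℕ → ℕ
search f i k zero       = 0
search f i k (suc fuel) = if iter f k i ≡ᵇ i then k else search f i (suc k) fuel

cycleLength : Perm∞ → ℕ → ℕ
cycleLength σ i = search (fun σ) i 1 (bound σ)

pointsInCyclesOfLength : Perm∞ → ℕ → ℕ
pointsInCyclesOfLength σ k =
  length (filter (λ i → cycleLength σ i ℕ.≟ k) (upTo (bound σ)))

cycleLengthsDown : Perm∞ → ℕ → List ℕ
cycleLengthsDown σ zero          = []
cycleLengthsDown σ (suc zero)    = []
cycleLengthsDown σ (suc (suc m)) =
  replicate (pointsInCyclesOfLength σ (suc (suc m)) / suc (suc m)) (suc (suc m))
  ++ cycleLengthsDown σ (suc m)

-- the cycle structure: non-increasing list of the lengths of the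
-- (nontrivial) disjoint cycles of σ
cycleStructure : Perm∞ → List ℕ
cycleStructure σ = cycleLengthsDown σ (bound σ)

record IsSubgroup (H : Pred Perm∞ 0ℓ) : Set where
  field
    resp  : ∀ {σ τ} → σ ≈ τ → H σ → H τ
    has-id : H idP
    ∙-closed : ∀ {σ τ} → H σ → H τ → H (σ ∙ τ)
    ⁻¹-closed : ∀ {σ} → H σ → H (σ ⁻¹)

IsCyclic : Pred Perm∞ 0ℓ → Set
IsCyclic H = Σ Perm∞ λ g → H g × (∀ σ → H σ → ∃[ k ] σ ≈ g ^ k)

IsNormalSubgroup : Pred Perm∞ 0ℓ → Pred Perm∞ 0ℓ → Set
IsNormalSubgroup N D =
  IsSubgroup N × (∀ σ → N σ → D σ) × (∀ d n → D d → N n → N (d ∙ n ∙ (d ⁻¹)))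

-- D/N is cyclic: some coset hN generates, i.e. every d ∈ D lies in hᵏN
QuotientCyclic : Pred Perm∞ 0ℓ → Pred Perm∞ 0ℓ → Set
QuotientCyclic D N =
  Σ Perm∞ λ h → D h × (∀ d → D d → ∃[ k ] N ((h ^ k) ⁻¹ ∙ d))

IsMetacyclic : Pred Perm∞ 0ℓ → Set₁
IsMetacyclic D =
  Σ (Pred Perm∞ 0ℓ) λ N → IsNormalSubgroup N D × IsCyclic N × QuotientCyclic D N

{-# OPTIONS --safe #-}
module Submission where

-- A permutation with cycle structure x moves at most s = 2·Σx points, so σ^(s!) = 1, and the
-- quotient σ⁻¹τ of two such permutations moves at most 2s points, so (σ⁻¹τ)^((2s)!) = 1.
-- Let D be metacyclic, with N = ⟨g⟩ normal in D and D/N = ⟨hN⟩, and let r and q be the orders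
-- of g and of hN.  If σ ∈ hᵅN with α < q and σ^M = 1, then h^(αM) ∈ N, so q ∣ αM and the coset
-- of σ is determined by αM/q < M.  Two such elements σ, τ in one coset differ by σ⁻¹τ = gᵏ with
-- k < r and g^(kK) = 1, so r ∣ kK and τ is determined by kK/r < K.  Hence M·K bounds the count,
-- for M = s! and K = (2s)!.

open import Defs
open import Level using (0ℓ)
open import Data.Bool using (true; false; T)
open import Data.Empty using (⊥-elim)
import Data.Integer as ℤ
open import Data.List using (List; []; _∷_; _++_; length; filter; upTo; replicate)
open import Data.List.Membership.Propositional using (_∈_)
open import Data.List.Membership.Propositional.Properties
  using (∈-∃++; ∈-++⁻; ∈-++⁺ˡ; ∈-++⁺ʳ; ∈-upTo⁺; ∈-filter⁺; ∈-filter⁻)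
open import Data.List.Properties
  using (filter-accept; filter-reject; length-++; length-map; length-upTo; length-applyUpTo)
open import Data.List.Relation.Unary.All using (All; []; _∷_)
import Data.List.Relation.Unary.All as All
import Data.List.Relation.Unary.All.Properties as All
open import Data.List.Relation.Unary.AllPairs using (AllPairs; []; _∷_)
import Data.List.Relation.Unary.AllPairs.Properties as AllPairs
open import Data.List.Relation.Unary.Any using (here; there)
open import Data.List.Relation.Unary.Unique.Propositional using (Unique)
import Data.List.Relation.Unary.Unique.Propositional.Properties as Unique
open import Data.Nat
  using (ℕ; zero; suc; _+_; _*_; _∸_; _⊔_; _≤_; _<_; _≟_; _≤?_; _<?_; _/_; _%_; _!; _≡ᵇ_; z≤n; s≤s; z<s; NonZero; >-nonZero)
open import Data.Nat.Properties
open import Data.Nat.DivMod using (m≡m%n+[m/n]*n; m%n<n; m*[n/m]≡n; m<n*o⇒m/o<n; m≥n⇒m/n>0)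
open import Data.Nat.Divisibility using (_∣_; divides; ∣-trans; m∣m*n; m%n≡0⇒n∣m; m≤n⇒m!∣n!)
open import Data.Nat.ListAction using (sum)
open import Data.Nat.ListAction.Properties using (sum-++)
open import Data.Product using (∃; ∃-syntax; _×_; _,_; proj₁; proj₂)
open import Data.Sum using (_⊎_; inj₁; inj₂; [_,_]′)
open import Data.Unit using (tt)
open import Function using (_∘_)
open import Relation.Binary using (Rel; Setoid; tri<; tri≈; tri>)
import Relation.Binary.Reasoning.Setoid as SetoidReasoning
open import Relation.Binary.PropositionalEquality
  using (_≡_; _≢_; refl; sym; trans; cong; subst; subst₂; module ≡-Reasoning)
open import Relation.Nullary using (¬_; Dec; yes; no)
open import Relation.Nullary.Decidable using (map′)
open import Relation.Unary using (Pred; Decidable; _∩_)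
open import Relation.Unary.Properties using (∁?)

variable
  A : Set
  σ τ ρ π π′ x : Perm∞

module _ (f : ℕ → ℕ) where
  open ≡-Reasoning

  iter-+ : ∀ m n i → iter f (m + n) i ≡ iter f m (iter f n i)
  iter-+ zero    n i = refl
  iter-+ (suc m) n i = cong f (iter-+ m n i)

  iter-comm : ∀ m n i → iter f m (iter f n i) ≡ iter f n (iter f m i)
  iter-comm m n i = begin
    iter f m (iter f n i)  ≡⟨ iter-+ m n i ⟨
    iter f (m + n) i       ≡⟨ cong (λ k → iter f k i) (+-comm m n) ⟩
    iter f (n + m) i       ≡⟨ iter-+ n m i ⟩
    iter f n (iter f m i)  ∎

  iter-fixed : ∀ n {i} → f i ≡ i → iter f n i ≡ i
  iter-fixed zero    fi≡i = refl
  iter-fixed (suc n) fi≡i = trans (cong f (iter-fixed n fi≡i)) fi≡i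

  iter-periodic : ∀ {ℓ m i} → ℓ ∣ m → iter f ℓ i ≡ i → iter f m i ≡ i
  iter-periodic {ℓ} {i = i} (divides c refl) ret = multiple c
    where
    multiple : ∀ c → iter f (c * ℓ) i ≡ i
    multiple zero    = refl
    multiple (suc c) = trans (iter-+ ℓ (c * ℓ) i) (trans (cong (iter f ℓ) (multiple c)) ret)

module _ (π : Perm∞) where
  open ≡-Reasoning

  private
    f : ℕ → ℕ
    f = fun π

  iter-injective : ∀ n {x y} → iter f n x ≡ iter f n y → x ≡ y
  iter-injective zero    eq = eq
  iter-injective (suc n) eq = iter-injective n (trans (sym (inv-fun π _)) (trans (cong (inv π) eq) (inv-fun π _)))

  iterate-returns⇒returns : ∀ m j {i} → iter f m (iter f j i) ≡ iter f j i → iter f m i ≡ i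
  iterate-returns⇒returns m j {i} ret = iter-injective j (trans (iter-comm f j m i) ret)

  iterate-moved : ∀ n {i} → f i ≢ i → f (iter f n i) ≢ iter f n i
  iterate-moved n moved = moved ∘ iterate-returns⇒returns 1 n

  iterates-distinct : ∀ {n i} → (∀ {m} → 0 < m → m < n → iter f m i ≢ i) →
                      ∀ {a b} → a < b → b < n → iter f a i ≢ iter f b i
  iterates-distinct {i = i} no-return {a} {b} a<b b<n eq =
    no-return (m<n⇒0<n∸m a<b) (≤-<-trans (m∸n≤m b a) b<n) (sym (iter-injective a (begin
      iter f a i                   ≡⟨ eq ⟩
      iter f b i                   ≡⟨ cong (λ k → iter f k i) (m∸n+n≡m (<⇒≤ a<b)) ⟨
      iter f (b ∸ a + a) i         ≡⟨ iter-+ f (b ∸ a) a i ⟩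
      iter f (b ∸ a) (iter f a i)  ≡⟨ iter-comm f (b ∸ a) a i ⟩
      iter f a (iter f (b ∸ a) i)  ∎)))

-- Counting elements of lists

module _ where
  open ≤-Reasoning

  private
    ∈-removed : ∀ ys {zs} {x w : A} → x ≢ w → w ∈ ys ++ x ∷ zs → w ∈ ys ++ zs
    ∈-removed ys x≢w w∈ with ∈-++⁻ ys w∈
    ... | inj₁ w∈ys         = ∈-++⁺ˡ w∈ys
    ... | inj₂ (here refl)  = ⊥-elim (x≢w refl)
    ... | inj₂ (there w∈zs) = ∈-++⁺ʳ ys w∈zs

  length-≤-⊆ : ∀ {xs ys : List A} → Unique xs → All (_∈ ys) xs → length xs ≤ length ys
  length-≤-⊆ {xs = []} _                   _                = z≤n
  length-≤-⊆ {xs = x ∷ xs} (x≢xs ∷ xs-unique) (x∈ys ∷ xs⊆ys) with ∈-∃++ x∈ys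
  ... | as , bs , refl = begin
    suc (length xs)              ≤⟨ s≤s (length-≤-⊆ xs-unique xs⊆as++bs) ⟩
    suc (length (as ++ bs))      ≡⟨ cong suc (length-++ as) ⟩
    suc (length as + length bs)  ≡⟨ +-suc (length as) (length bs) ⟨
    length as + length (x ∷ bs)  ≡⟨ length-++ as ⟨
    length (as ++ x ∷ bs)        ∎
    where
    xs⊆as++bs : All (_∈ as ++ bs) xs
    xs⊆as++bs = All.zipWith (λ (x≢w , w∈) → ∈-removed as x≢w w∈) (x≢xs , xs⊆ys)

  ≤-length-injection : ∀ {n} {ys : List A} (h : ℕ → A) →
                       (∀ {a b} → a < b → b < n → h a ≢ h b) → (∀ {a} → a < n → h a ∈ ys) → n ≤ length ys
  ≤-length-injection {n = n} h h-injective h∈ys = subst (_≤ _) (length-applyUpTo h n)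
    (length-≤-⊆ (Unique.applyUpTo⁺₁ h n h-injective) (All.applyUpTo⁺₁ h n h∈ys))

  length-≤-code : ∀ {K} {zs : List A} (c : A → ℕ) →
                  All (λ z → c z < K) zs → AllPairs (λ a b → c a ≢ c b) zs → length zs ≤ K
  length-≤-code {K = K} {zs = zs} c c<K c-distinct = subst₂ _≤_ (length-map c zs) (length-upTo K)
    (length-≤-⊆ (AllPairs.map⁺ {f = c} c-distinct) (All.map⁺ (All.map ∈-upTo⁺ c<K)))

  AllPairs-mapWith : ∀ {c r s} {C : Pred A c} {R : Rel A r} {S : Rel A s} →
                     (∀ {a b} → C a → C b → R a b → S a b) →
                     ∀ {xs} → All C xs → AllPairs R xs → AllPairs S xs
  AllPairs-mapWith f []        []        = []
  AllPairs-mapWith f (ca ∷ cs) (ra ∷ rs) =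
    All.zipWith (λ (cb , rab) → f ca cb rab) (cs , ra) ∷ AllPairs-mapWith f cs rs

  length-filter-split : ∀ {p} {P : Pred A p} (P? : Decidable P) xs →
                        length xs ≡ length (filter P? xs) + length (filter (∁? P?) xs)
  length-filter-split P? []       = refl
  length-filter-split P? (x ∷ xs) with P? x
  ... | yes _ = cong suc (length-filter-split P? xs)
  ... | no  _ = trans (cong suc (length-filter-split P? xs)) (sym (+-suc _ _))

  length-≤-fibres : ∀ {c r} {C : Pred A c} {R : Rel A r} (f : A → ℕ) {K} →
    (∀ {t zs} → All C zs → AllPairs R zs → All (λ z → f z ≡ t) zs → length zs ≤ K) →
    ∀ m {ys} → All C ys → AllPairs R ys → All (λ y → f y < m) ys → length ys ≤ m * K
  length-≤-fibres f fibre zero    {[]}    _  _  _          = z≤n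
  length-≤-fibres f fibre zero    {_ ∷ _} _  _  (() ∷ _)
  length-≤-fibres f {K = K} fibre (suc m) {ys} cs rs f<1+m = begin
    length ys                                        ≡⟨ length-filter-split (f≟ m) ys ⟩
    length (filter (f≟ m) ys) + length (filter f≢? ys) ≤⟨ +-mono-≤ top rest ⟩
    K + m * K                                        ∎
    where
    f≟ : ∀ t → Decidable (λ y → f y ≡ t)
    f≟ t y = f y ≟ t
    f≢? : Decidable (λ y → f y ≢ m)
    f≢? = ∁? (f≟ m)
    top : length (filter (f≟ m) ys) ≤ K
    top = fibre (All.filter⁺ (f≟ m) cs) (AllPairs.filter⁺ (f≟ m) rs) (All.all-filter (f≟ m) ys)
    rest : length (filter f≢? ys) ≤ m * K
    rest = length-≤-fibres f fibre m (All.filter⁺ f≢? cs) (AllPairs.filter⁺ f≢? rs)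
      (All.zipWith (λ (fy<1+m , fy≢m) → ≤∧≢⇒< (≤-pred fy<1+m) fy≢m)
                   (All.filter⁺ f≢? f<1+m , All.all-filter f≢? ys))

module _ {p} {P : Pred ℕ p} (P? : Decidable P) where

  searchBelow : ∀ n → (∃ λ m → m < n × P m × (∀ {j} → j < m → ¬ P j)) ⊎ (∀ {j} → j < n → ¬ P j)
  searchBelow zero    = inj₂ λ ()
  searchBelow (suc n) with searchBelow n
  ... | inj₁ (m , m<n , pm , below-m) = inj₁ (m , m<n⇒m<1+n m<n , pm , below-m)
  ... | inj₂ below-n with P? n
  ...   | yes pn  = inj₁ (n , n<1+n n , pn , below-n)
  ...   | no  ¬pn = inj₂ λ j<1+n → [ below-n , (λ { refl → ¬pn }) ]′ (m<1+n⇒m<n∨m≡n j<1+n)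

  firstBelow : ℕ → ℕ
  firstBelow n with searchBelow n
  ... | inj₁ (m , _) = m
  ... | inj₂ _       = n

  firstBelow-spec : ∀ {n j} → j < n → P j → firstBelow n < n × P (firstBelow n)
  firstBelow-spec {n} j<n pj with searchBelow n
  ... | inj₁ (m , m<n , pm , _) = m<n , pm
  ... | inj₂ below-n            = ⊥-elim (below-n j<n pj)

record IsLeastPositive {p} (P : Pred ℕ p) (k : ℕ) : Set p where
  field
    positive : 0 < k
    holds    : P k
    minimal  : ∀ {j} → 0 < j → j < k → ¬ P j

module _ {p} {P : Pred ℕ p} where
  open IsLeastPositive

  leastPositive : Decidable P → ∀ {n} → 0 < n → P n → ∃ (IsLeastPositive P)
  leastPositive P? {suc n} _ pn with searchBelow (P? ∘ suc) (suc n)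
  ... | inj₁ (m , _ , pm , below-m) = suc m , record
    { positive = s≤s z≤n
    ; holds    = pm
    ; minimal  = λ { {suc j} _ (s≤s j<m) → below-m j<m }
    }
  ... | inj₂ below-n = ⊥-elim (below-n (n<1+n n) pn)

  IsLeastPositive-unique : ∀ {k k′} → IsLeastPositive P k → IsLeastPositive P k′ → k ≡ k′
  IsLeastPositive-unique {k} {k′} l l′ with <-cmp k k′
  ... | tri< k<k′ _ _ = ⊥-elim (minimal l′ (positive l) k<k′ (holds l))
  ... | tri≈ _ k≡k′ _ = k≡k′
  ... | tri> _ _ k′<k = ⊥-elim (minimal l (positive l′) k′<k (holds l′))

  IsLeastPositive-∣ : ∀ {k m} → IsLeastPositive P k → (∀ {a c} → P (a + c * k) → P a) → P m → k ∣ m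
  IsLeastPositive-∣ {k} {m} l reduce pm = m%n≡0⇒n∣m m k (remainder≡0 (m % k) (m%n<n m k) p[m%k])
    where
    instance
      k-nonZero : NonZero k
      k-nonZero = >-nonZero (positive l)
    p[m%k] : P (m % k)
    p[m%k] = reduce {m % k} {m / k} (subst P (m≡m%n+[m/n]*n m k) pm)
    remainder≡0 : ∀ j → j < k → P j → j ≡ 0
    remainder≡0 zero    _   _  = refl
    remainder≡0 (suc j) j<k pj = ⊥-elim (minimal l (s≤s z≤n) j<k pj)

-- Orbits of a permutation

∣-! : ∀ {ℓ T} → 0 < ℓ → ℓ ≤ T → ℓ ∣ T !
∣-! {suc k} _ ℓ≤T = ∣-trans (m∣m*n (k !)) (m≤n⇒m!∣n! ℓ≤T)

module _ (π : Perm∞) {L : List ℕ} (moved∈L : ∀ x → fun π x ≢ x → x ∈ L) where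

  private
    f : ℕ → ℕ
    f = fun π

  -- Pigeonhole: if i did not return, the L + 1 points i, f i, …, f^L i would be distinct moved points, all in L.
  returns : ∀ {i} → f i ≢ i → ∃ λ ℓ → 0 < ℓ × ℓ ≤ length L × iter f ℓ i ≡ i
  returns {i} moved with searchBelow (λ j → iter f (suc j) i ≟ i) (length L)
  ... | inj₁ (j , j<L , ret , _) = suc j , s≤s z≤n , j<L , ret
  ... | inj₂ no-return = ⊥-elim (<-irrefl refl (≤-length-injection (λ a → iter f a i) distinct iterate∈L))
    where
    distinct : ∀ {a b} → a < b → b < suc (length L) → iter f a i ≢ iter f b i
    distinct = iterates-distinct π λ { {suc j} _ (s≤s j<L) → no-return j<L }
    iterate∈L : ∀ {a} → a < suc (length L) → iter f a i ∈ L
    iterate∈L {a} _ = moved∈L _ (iterate-moved π a moved)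

  iter-!-fixes : ∀ {T} → length L ≤ T → ∀ i → iter f (T !) i ≡ i
  iter-!-fixes {T} L≤T i with f i ≟ i
  ... | yes fixed = iter-fixed f (T !) fixed
  ... | no moved with returns moved
  ...   | ℓ , 0<ℓ , ℓ≤L , ret = iter-periodic f (∣-! 0<ℓ (≤-trans ℓ≤L L≤T)) ret

infix 4 _≉_
_≉_ : Rel Perm∞ 0ℓ
σ ≉ τ = ¬ (σ ≈ τ)

≈-setoid : Setoid 0ℓ 0ℓ
≈-setoid = record
  { Carrier       = Perm∞
  ; _≈_           = _≈_
  ; isEquivalence = record
    { refl  = λ _ → refl
    ; sym   = λ σ≈τ i → sym (σ≈τ i)
    ; trans = λ σ≈τ τ≈ρ i → trans (σ≈τ i) (τ≈ρ i)
    }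
  }

module ≈-Reasoning = SetoidReasoning ≈-setoid

∙-cong : ∀ {σ σ′ τ τ′} → σ ≈ σ′ → τ ≈ τ′ → σ ∙ τ ≈ σ′ ∙ τ′
∙-cong {σ} σ≈σ′ τ≈τ′ i = trans (cong (fun σ) (τ≈τ′ i)) (σ≈σ′ _)

⁻¹-cong : σ ≈ τ → σ ⁻¹ ≈ τ ⁻¹
⁻¹-cong {σ} {τ} σ≈τ i = trans (sym (inv-fun τ (inv σ i))) (cong (inv τ) (trans (sym (σ≈τ _)) (fun-inv σ i)))

∙-cancelˡ : ρ ∙ σ ≈ ρ ∙ τ → σ ≈ τ
∙-cancelˡ {ρ} eq i = trans (sym (inv-fun ρ _)) (trans (cong (inv ρ) (eq i)) (inv-fun ρ _))

⁻¹∙≈idP⇒≈ : σ ⁻¹ ∙ τ ≈ idP → σ ≈ τ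
⁻¹∙≈idP⇒≈ {σ} {τ} eq i = trans (cong (fun σ) (sym (eq i))) (fun-inv σ (fun τ i))

^ⁿ-cong : σ ≈ τ → ∀ n → σ ^ⁿ n ≈ τ ^ⁿ n
^ⁿ-cong σ≈τ zero    i = refl
^ⁿ-cong {σ} {τ} σ≈τ (suc n) = ∙-cong {σ} {τ} {σ ^ⁿ n} {τ ^ⁿ n} σ≈τ (^ⁿ-cong σ≈τ n)

^ⁿ-+ : ∀ π m n → π ^ⁿ (m + n) ≈ π ^ⁿ m ∙ π ^ⁿ n
^ⁿ-+ π zero    n i = refl
^ⁿ-+ π (suc m) n i = cong (fun π) (^ⁿ-+ π m n i)

^ⁿ-* : ∀ π m n → π ^ⁿ (m * n) ≈ (π ^ⁿ n) ^ⁿ m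
^ⁿ-* π zero    n i = refl
^ⁿ-* π (suc m) n i = trans (^ⁿ-+ π n (m * n) i) (cong (fun (π ^ⁿ n)) (^ⁿ-* π m n i))

fun-^ⁿ : ∀ π n i → fun (π ^ⁿ n) i ≡ iter (fun π) n i
fun-^ⁿ π zero    i = refl
fun-^ⁿ π (suc n) i = cong (fun π) (fun-^ⁿ π n i)

moved⇒<bound : ∀ π {i} → fun π i ≢ i → i < bound π
moved⇒<bound π {i} moved = ≰⇒> λ bound≤i → moved (fixes π i bound≤i)

infix 4 _≈?_
_≈?_ : ∀ σ τ → Dec (σ ≈ τ)
σ ≈? τ = map′ agree-everywhere (λ σ≈τ → All.tabulate λ _ → σ≈τ _)
              (All.all? (λ i → fun σ i ≟ fun τ i) (upTo b))
  where
  b : ℕ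
  b = bound σ ⊔ bound τ
  agree-everywhere : All (λ i → fun σ i ≡ fun τ i) (upTo b) → σ ≈ τ
  agree-everywhere below i with i <? b
  ... | yes i<b = All.lookup below (∈-upTo⁺ i<b)
  ... | no  i≮b = trans (fixes σ i (≤-trans (m≤m⊔n _ _) (≮⇒≥ i≮b)))
                        (sym (fixes τ i (≤-trans (m≤n⊔m _ _) (≮⇒≥ i≮b))))

^ⁿ-!≈idP : ∀ π {L T} → (∀ x → fun π x ≢ x → x ∈ L) → length L ≤ T → π ^ⁿ (T !) ≈ idP
^ⁿ-!≈idP π {T = T} moved∈L L≤T i = trans (fun-^ⁿ π (T !) i) (iter-!-fixes π moved∈L L≤T i)

^ⁿ-bound!≈idP : ∀ π → π ^ⁿ (bound π !) ≈ idP
^ⁿ-bound!≈idP π = ^ⁿ-!≈idP π (λ _ moved → ∈-upTo⁺ (moved⇒<bound π moved)) (≤-reflexive (length-upTo (bound π)))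

^-as-^ⁿ : ∀ π z → ∃ λ n → π ^ z ≈ π ^ⁿ n
^-as-^ⁿ π (ℤ.+ n)    = n , λ _ → refl
^-as-^ⁿ π ℤ.-[1+ n ] with bound π ! | ^ⁿ-bound!≈idP π | 1≤n! (bound π)
... | suc P | πᴾ⁺¹≈idP | _ = suc n * P , (begin
  (π ⁻¹) ^ⁿ suc n     ≈⟨ ^ⁿ-cong π⁻¹≈πᴾ (suc n) ⟩
  (π ^ⁿ P) ^ⁿ suc n   ≈⟨ ^ⁿ-* π (suc n) P ⟨
  π ^ⁿ (suc n * P)    ∎)
  where
  open ≈-Reasoning
  π⁻¹≈πᴾ : π ⁻¹ ≈ π ^ⁿ P
  π⁻¹≈πᴾ i = trans (cong (inv π) (sym (πᴾ⁺¹≈idP i))) (inv-fun π _)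

≈idP-isSubgroup : IsSubgroup (_≈ idP)
≈idP-isSubgroup = record
  { resp      = λ σ≈τ σ≈idP i → trans (sym (σ≈τ i)) (σ≈idP i)
  ; has-id    = λ _ → refl
  ; ∙-closed  = λ {σ} {τ} → ∙-cong {σ} {idP} {τ} {idP}
  ; ⁻¹-closed = λ {σ} σ≈idP i → trans (cong (inv σ) (sym (σ≈idP i))) (inv-fun σ i)
  }

module _ {H : Pred Perm∞ 0ℓ} (H-sub : IsSubgroup H) where
  open IsSubgroup H-sub

  ^ⁿ-closed : H π → ∀ n → H (π ^ⁿ n)
  ^ⁿ-closed π∈H zero    = has-id
  ^ⁿ-closed π∈H (suc n) = ∙-closed π∈H (^ⁿ-closed π∈H n)

  coset-sym : H (σ ⁻¹ ∙ τ) → H (τ ⁻¹ ∙ σ)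
  coset-sym σ~τ = resp (λ _ → refl) (⁻¹-closed σ~τ)

  coset-trans : H (ρ ⁻¹ ∙ σ) → H (σ ⁻¹ ∙ τ) → H (ρ ⁻¹ ∙ τ)
  coset-trans {ρ} {σ} {τ} ρ~σ σ~τ = resp (λ i → cong (inv ρ) (fun-inv σ (fun τ i))) (∙-closed ρ~σ σ~τ)

  coset-∈ : H (σ ⁻¹ ∙ τ) → H τ → H σ
  coset-∈ {σ} {τ} σ~τ τ∈H = resp (λ i → fun-inv τ (fun σ i)) (∙-closed τ∈H (⁻¹-closed σ~τ))

-- For H trivial the index is the order of x; for H normal in D ∋ x it is the order of xH in D/H.
module PowerIndex {H : Pred Perm∞ 0ℓ} (H-sub : IsSubgroup H) (H? : Decidable H) (x : Perm∞) where
  open IsSubgroup H-sub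
  open ≡-Reasoning

  opaque
    private
      least : ∃ (IsLeastPositive (λ j → H (x ^ⁿ j)))
      least = leastPositive (λ j → H? (x ^ⁿ j)) (1≤n! (bound x)) (resp (λ i → sym (^ⁿ-bound!≈idP x i)) has-id)

    index : ℕ
    index = proj₁ least

    index-isLeastPositive : IsLeastPositive (λ j → H (x ^ⁿ j)) index
    index-isLeastPositive = proj₂ least

  instance
    index-nonZero : NonZero index
    index-nonZero = >-nonZero (IsLeastPositive.positive index-isLeastPositive)

  ^ⁿ-+-*index : ∀ a c → H ((x ^ⁿ a) ⁻¹ ∙ x ^ⁿ (a + c * index))
  ^ⁿ-+-*index a c = resp (λ i → sym (shift i)) (^ⁿ-closed H-sub (IsLeastPositive.holds index-isLeastPositive) c)
    where
    shift : (x ^ⁿ a) ⁻¹ ∙ x ^ⁿ (a + c * index) ≈ (x ^ⁿ index) ^ⁿ c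
    shift i = begin
      inv (x ^ⁿ a) (fun (x ^ⁿ (a + c * index)) i)                ≡⟨ cong (inv (x ^ⁿ a)) (^ⁿ-+ x a (c * index) i) ⟩
      inv (x ^ⁿ a) (fun (x ^ⁿ a) (fun (x ^ⁿ (c * index)) i))     ≡⟨ inv-fun (x ^ⁿ a) _ ⟩
      fun (x ^ⁿ (c * index)) i                                   ≡⟨ ^ⁿ-* x c index i ⟩
      fun ((x ^ⁿ index) ^ⁿ c) i                                  ∎

  ^ⁿ-%index : ∀ m → H ((x ^ⁿ (m % index)) ⁻¹ ∙ x ^ⁿ m)
  ^ⁿ-%index m = subst (λ k → H ((x ^ⁿ (m % index)) ⁻¹ ∙ x ^ⁿ k)) (sym (m≡m%n+[m/n]*n m index))
                      (^ⁿ-+-*index (m % index) (m / index))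

  index-∣ : ∀ {m} → H (x ^ⁿ m) → index ∣ m
  index-∣ = IsLeastPositive-∣ index-isLeastPositive λ {a} {c} → coset-∈ H-sub (^ⁿ-+-*index a c)

-- Cycle lengths

module _ (f : ℕ → ℕ) (i : ℕ) where

  Returns-from : ℕ → ℕ → ℕ → Set
  Returns-from k fuel s =
    (s ≡ 0 × (∀ {m} → k ≤ m → m < k + fuel → iter f m i ≢ i)) ⊎
    (k ≤ s × s < k + fuel × iter f s i ≡ i × (∀ {m} → k ≤ m → m < s → iter f m i ≢ i))

  private
    skip-first : ∀ {k m} → iter f k i ≢ i → k ≤ m → (k < m → iter f m i ≢ i) → iter f m i ≢ i
    skip-first k-stays k≤m beyond-k with m≤n⇒m<n∨m≡n k≤m
    ... | inj₁ k<m  = beyond-k k<m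
    ... | inj₂ refl = k-stays

  Returns-from-suc : ∀ {k fuel s} → iter f k i ≢ i → Returns-from (suc k) fuel s → Returns-from k (suc fuel) s
  Returns-from-suc {k} {fuel} k-stays (inj₁ (s≡0 , none)) = inj₁ (s≡0 , λ {m} k≤m m<k+1+fuel →
    skip-first k-stays k≤m (λ k<m → none k<m (subst (m <_) (+-suc k fuel) m<k+1+fuel)))
  Returns-from-suc {k} {fuel} {s} k-stays (inj₂ (k<s , s<1+k+fuel , ret , below-s)) =
    inj₂ (<⇒≤ k<s , subst (s <_) (sym (+-suc k fuel)) s<1+k+fuel , ret ,
          λ k≤m m<s → skip-first k-stays k≤m (λ k<m → below-s k<m m<s))

  search-spec : ∀ k fuel → Returns-from k fuel (search f i k fuel)
  search-spec k zero = inj₁ (refl , λ k≤m m<k+0 → ⊥-elim (<⇒≱ (subst (_ <_) (+-identityʳ k) m<k+0) k≤m))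
  search-spec k (suc fuel) with iter f k i ≡ᵇ i in eq
  ... | true  = inj₂ (≤-refl , m<m+n k z<s , ≡ᵇ⇒≡ _ _ (subst T (sym eq) tt) , λ k≤m m<k → ⊥-elim (<⇒≱ m<k k≤m))
  ... | false = Returns-from-suc (λ ret → subst T eq (≡⇒≡ᵇ _ _ ret)) (search-spec (suc k) fuel)

Returns : Perm∞ → ℕ → ℕ → Set
Returns σ i m = iter (fun σ) m i ≡ i

cycleLength-spec : ∀ σ i →
  (cycleLength σ i ≡ 0 × (∀ {m} → 0 < m → m ≤ bound σ → ¬ Returns σ i m)) ⊎
  (IsLeastPositive (Returns σ i) (cycleLength σ i) × cycleLength σ i ≤ bound σ)
cycleLength-spec σ i with search-spec (fun σ) i 1 (bound σ)
... | inj₁ (≡0 , none) = inj₁ (≡0 , λ 0<m m≤B → none 0<m (s≤s m≤B))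
... | inj₂ (1≤s , s<1+B , ret , below-s) =
  inj₂ (record { positive = 1≤s ; holds = ret ; minimal = below-s } , ≤-pred s<1+B)

cycleLength-≤-bound : ∀ σ i → cycleLength σ i ≤ bound σ
cycleLength-≤-bound σ i with cycleLength-spec σ i
... | inj₁ (≡0 , _)     = subst (_≤ bound σ) (sym ≡0) z≤n
... | inj₂ (_ , ≤bound) = ≤bound

cycleLength-unique : ∀ σ {i k} → IsLeastPositive (Returns σ i) k → k ≤ bound σ → cycleLength σ i ≡ k
cycleLength-unique σ {i} least k≤B with cycleLength-spec σ i
... | inj₁ (_ , none)    = ⊥-elim (none (IsLeastPositive.positive least) k≤B (IsLeastPositive.holds least))
... | inj₂ (least′ , _) = IsLeastPositive-unique least′ least

moved⇒2≤cycleLength : ∀ σ {i} → fun σ i ≢ i → 2 ≤ cycleLength σ i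
moved⇒2≤cycleLength σ {i} moved with cycleLength-spec σ i
  | returns σ (λ _ moved → ∈-upTo⁺ (moved⇒<bound σ moved)) moved
... | inj₁ (_ , none) | ℓ , 0<ℓ , ℓ≤B , ret = ⊥-elim (none 0<ℓ (subst (ℓ ≤_) (length-upTo (bound σ)) ℓ≤B) ret)
... | inj₂ (least , _) | _ = ≤∧≢⇒< (IsLeastPositive.positive least)
                                   (λ 1≡cl → moved (subst (Returns σ i) (sym 1≡cl) (IsLeastPositive.holds least)))

IsLeastPositive-iterate : ∀ σ {i k} → IsLeastPositive (Returns σ i) k →
                          ∀ j → IsLeastPositive (Returns σ (iter (fun σ) j i)) k
IsLeastPositive-iterate σ {i} {k} least j = record
  { positive = positive
  ; holds    = trans (iter-comm (fun σ) k j i) (cong (iter (fun σ) j) holds)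
  ; minimal  = λ {m} 0<m m<k ret → minimal 0<m m<k (iterate-returns⇒returns σ m j ret)
  }
  where open IsLeastPositive least

-- Distinct points x, σ x, …, σᵏ⁻¹ x of a k-cycle all lie in cycles of length k.
cycleLength≤pointsInCyclesOfLength : ∀ σ {i} → 2 ≤ cycleLength σ i →
  cycleLength σ i ≤ pointsInCyclesOfLength σ (cycleLength σ i)
cycleLength≤pointsInCyclesOfLength σ {i} 2≤k with cycleLength-spec σ i
... | inj₁ (≡0 , _) = ⊥-elim (<⇒≢ (≤-trans (s≤s z≤n) 2≤k) (sym ≡0))
... | inj₂ (least , _) = ≤-length-injection (λ j → iter (fun σ) j i)
                           (iterates-distinct σ (IsLeastPositive.minimal least)) iterate∈
  where
  k : ℕ
  k = cycleLength σ i
  moved : fun σ i ≢ i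
  moved = IsLeastPositive.minimal least (s≤s z≤n) 2≤k
  iterate∈ : ∀ {j} → j < k → iter (fun σ) j i ∈ filter (λ x → cycleLength σ x ≟ k) (upTo (bound σ))
  iterate∈ {j} _ = ∈-filter⁺ (λ x → cycleLength σ x ≟ k)
    (∈-upTo⁺ (moved⇒<bound σ (iterate-moved σ j moved)))
    (cycleLength-unique σ (IsLeastPositive-iterate σ least j) (cycleLength-≤-bound σ i))

-- The support of a permutation and its cycle structure

module _ {A : Set} (f : A → ℕ) where

  countValue : ℕ → List A → ℕ
  countValue k xs = length (filter (λ x → f x ≟ k) xs)

  countValues≥2 : ℕ → List A → ℕ
  countValues≥2 zero          xs = 0
  countValues≥2 (suc zero)    xs = 0
  countValues≥2 (suc (suc m)) xs = countValue (suc (suc m)) xs + countValues≥2 (suc m) xs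

  countValue-∷-≡ : ∀ {x} xs {k} → f x ≡ k → countValue k (x ∷ xs) ≡ suc (countValue k xs)
  countValue-∷-≡ xs {k} fx≡k = cong length (filter-accept (λ x → f x ≟ k) fx≡k)

  countValue-∷ : ∀ x xs k → countValue k xs ≤ countValue k (x ∷ xs)
  countValue-∷ x xs k with f x ≟ k
  ... | yes fx≡k = subst (countValue k xs ≤_) (sym (countValue-∷-≡ xs fx≡k)) (n≤1+n _)
  ... | no  fx≢k = ≤-reflexive (sym (cong length (filter-reject (λ x → f x ≟ k) fx≢k)))

  countValues≥2-∷ : ∀ x xs n → countValues≥2 n xs ≤ countValues≥2 n (x ∷ xs)
  countValues≥2-∷ x xs zero          = z≤n
  countValues≥2-∷ x xs (suc zero)    = z≤n
  countValues≥2-∷ x xs (suc (suc m)) = +-mono-≤ (countValue-∷ x xs (suc (suc m))) (countValues≥2-∷ x xs (suc m))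

  countValues≥2-∷-hit : ∀ {x} xs n → 2 ≤ f x → f x ≤ n → suc (countValues≥2 n xs) ≤ countValues≥2 n (x ∷ xs)
  countValues≥2-∷-hit {x} xs (suc (suc m)) 2≤fx fx≤n =
    step (m≤n⇒m<n∨m≡n fx≤n) (countValues≥2-∷-hit xs (suc m) 2≤fx)
    where
    n : ℕ
    n = suc (suc m)
    step : f x < n ⊎ f x ≡ n → (f x ≤ suc m → suc (countValues≥2 (suc m) xs) ≤ countValues≥2 (suc m) (x ∷ xs)) →
           suc (countValues≥2 n xs) ≤ countValues≥2 n (x ∷ xs)
    step (inj₂ fx≡n) _ = +-mono-≤ (≤-reflexive (sym (countValue-∷-≡ xs fx≡n))) (countValues≥2-∷ x xs (suc m))
    step (inj₁ fx<n) below-n = subst (_≤ countValues≥2 n (x ∷ xs)) (+-suc _ _)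
      (+-mono-≤ (countValue-∷ x xs n) (below-n (≤-pred fx<n)))
  countValues≥2-∷-hit xs zero       2≤fx fx≤0 = ⊥-elim (<⇒≱ (≤-trans 2≤fx fx≤0) z≤n)
  countValues≥2-∷-hit xs (suc zero) 2≤fx fx≤1 = ⊥-elim (<⇒≱ (≤-trans 2≤fx fx≤1) ≤-refl)

  length-filter-≥2 : ∀ n xs → All (λ x → f x ≤ n) xs → length (filter (λ x → 2 ≤? f x) xs) ≤ countValues≥2 n xs
  length-filter-≥2 n []       []                 = z≤n
  length-filter-≥2 n (x ∷ xs) (fx≤n ∷ xs≤n) with 2 ≤? f x
  ... | yes 2≤fx = subst (_≤ countValues≥2 n (x ∷ xs)) (sym (cong length (filter-accept (λ x → 2 ≤? f x) 2≤fx)))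
                     (≤-trans (s≤s (length-filter-≥2 n xs xs≤n)) (countValues≥2-∷-hit xs n 2≤fx fx≤n))
  ... | no  2≰fx = subst (_≤ countValues≥2 n (x ∷ xs)) (sym (cong length (filter-reject (λ x → 2 ≤? f x) 2≰fx)))
                     (≤-trans (length-filter-≥2 n xs xs≤n) (countValues≥2-∷ x xs n))

n≤m⇒m≤2*[m/n*n] : ∀ {m n} .{{_ : NonZero n}} → n ≤ m → m ≤ 2 * (m / n * n)
n≤m⇒m≤2*[m/n*n] {m} {n} n≤m = begin
  m                      ≡⟨ m≡m%n+[m/n]*n m n ⟩
  m % n + m / n * n      ≤⟨ +-monoˡ-≤ (m / n * n) (<⇒≤ (<-≤-trans (m%n<n m n) n≤m/n*n)) ⟩
  m / n * n + m / n * n  ≡⟨ cong (m / n * n +_) (+-identityʳ (m / n * n)) ⟨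
  2 * (m / n * n)        ∎
  where
  open ≤-Reasoning
  n≤m/n*n : n ≤ m / n * n
  n≤m/n*n = subst (_≤ m / n * n) (*-identityˡ n) (*-monoˡ-≤ n (m≥n⇒m/n>0 n≤m))

pointsInCyclesOfLength≡0⊎≥ : ∀ σ {k} → 2 ≤ k → pointsInCyclesOfLength σ k ≡ 0 ⊎ k ≤ pointsInCyclesOfLength σ k
pointsInCyclesOfLength≡0⊎≥ σ {k} 2≤k with filter (λ i → cycleLength σ i ≟ k) (upTo (bound σ)) in eq
... | []    = inj₁ refl
... | x ∷ _ with ∈-filter⁻ (λ i → cycleLength σ i ≟ k) {xs = upTo (bound σ)} (subst (x ∈_) (sym eq) (here refl))
...   | _ , cl≡k = inj₂ (subst₂ _≤_ cl≡k (trans (cong (pointsInCyclesOfLength σ) cl≡k) (cong length eq))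
                               (cycleLength≤pointsInCyclesOfLength σ (subst (2 ≤_) (sym cl≡k) 2≤k)))

-- The count is in fact a multiple of k; the weaker bound suffices.
pointsInCyclesOfLength-≤ : ∀ σ {k} .{{_ : NonZero k}} → 2 ≤ k →
  pointsInCyclesOfLength σ k ≤ 2 * (pointsInCyclesOfLength σ k / k * k)
pointsInCyclesOfLength-≤ σ 2≤k with pointsInCyclesOfLength≡0⊎≥ σ 2≤k
... | inj₁ ≡0  = ≤-trans (≤-reflexive ≡0) z≤n
... | inj₂ k≤p = n≤m⇒m≤2*[m/n*n] k≤p

sum-replicate : ∀ n k → sum (replicate n k) ≡ n * k
sum-replicate zero    k = refl
sum-replicate (suc n) k = cong (k +_) (sum-replicate n k)

countValues≥2-≤-2*sum : ∀ σ n → countValues≥2 (cycleLength σ) n (upTo (bound σ)) ≤ 2 * sum (cycleLengthsDown σ n)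
countValues≥2-≤-2*sum σ zero          = z≤n
countValues≥2-≤-2*sum σ (suc zero)    = z≤n
countValues≥2-≤-2*sum σ (suc (suc m)) = begin
  p + countValues≥2 (cycleLength σ) (suc m) (upTo (bound σ))
    ≤⟨ +-mono-≤ (pointsInCyclesOfLength-≤ σ (s≤s (s≤s z≤n))) (countValues≥2-≤-2*sum σ (suc m)) ⟩
  2 * (p / k * k) + 2 * sum rest            ≡⟨ *-distribˡ-+ 2 (p / k * k) (sum rest) ⟨
  2 * (p / k * k + sum rest)                ≡⟨ cong (λ s → 2 * (s + sum rest)) (sum-replicate (p / k) k) ⟨
  2 * (sum (replicate (p / k) k) + sum rest) ≡⟨ cong (2 *_) (sum-++ (replicate (p / k) k) rest) ⟨
  2 * sum (replicate (p / k) k ++ rest)     ∎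
  where
  open ≤-Reasoning
  k p : ℕ
  k = suc (suc m)
  p = pointsInCyclesOfLength σ k
  rest : List ℕ
  rest = cycleLengthsDown σ (suc m)

support : Perm∞ → List ℕ
support σ = filter (λ i → 2 ≤? cycleLength σ i) (upTo (bound σ))

moved∈support : ∀ σ {i} → fun σ i ≢ i → i ∈ support σ
moved∈support σ moved =
  ∈-filter⁺ (λ i → 2 ≤? cycleLength σ i) (∈-upTo⁺ (moved⇒<bound σ moved)) (moved⇒2≤cycleLength σ moved)

length-support : ∀ σ → length (support σ) ≤ 2 * sum (cycleStructure σ)
length-support σ = ≤-trans
  (length-filter-≥2 (cycleLength σ) (bound σ) (upTo (bound σ)) (All.tabulate λ {i} _ → cycleLength-≤-bound σ i))
  (countValues≥2-≤-2*sum σ (bound σ))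

^ⁿ-!≈idP-support : ∀ {s} → length (support σ) ≤ s → σ ^ⁿ (s !) ≈ idP
^ⁿ-!≈idP-support {σ} = ^ⁿ-!≈idP σ (λ _ → moved∈support σ)

⁻¹∙-^ⁿ-!≈idP-support : ∀ {s t} → length (support σ) ≤ s → length (support τ) ≤ t → (σ ⁻¹ ∙ τ) ^ⁿ ((s + t) !) ≈ idP
⁻¹∙-^ⁿ-!≈idP-support {σ} {τ} {s} {t} σ≤s τ≤t =
  ^ⁿ-!≈idP (σ ⁻¹ ∙ τ) moved∈ (subst (_≤ s + t) (sym (length-++ (support σ))) (+-mono-≤ σ≤s τ≤t))
  where
  moved∈ : ∀ x → inv σ (fun τ x) ≢ x → x ∈ support σ ++ support τ
  moved∈ x moved with fun τ x ≟ x
  ... | no τ-moves = ∈-++⁺ʳ (support σ) (moved∈support τ τ-moves)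
  ... | yes τ-fixes = ∈-++⁺ˡ (moved∈support σ λ σ-fixes →
    moved (trans (cong (inv σ) (trans τ-fixes (sym σ-fixes))) (inv-fun σ x)))

-- Counting elements of bounded order in a metacyclic subgroup

*-/-< : ∀ {i n} E .{{_ : NonZero n}} .{{_ : NonZero E}} → i < n → E * i / n < E
*-/-< E i<n = m<n*o⇒m/o<n (*-monoʳ-< E i<n)

*-/-injective : ∀ {i j n} E .{{_ : NonZero n}} .{{_ : NonZero E}} →
                n ∣ E * i → n ∣ E * j → E * i / n ≡ E * j / n → i ≡ j
*-/-injective {i} {j} {n} E n∣E*i n∣E*j eq = *-cancelˡ-≡ i j E (begin
  E * i            ≡⟨ m*[n/m]≡n n∣E*i ⟨
  n * (E * i / n)  ≡⟨ cong (n *_) eq ⟩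
  n * (E * j / n)  ≡⟨ m*[n/m]≡n n∣E*j ⟩
  E * j            ∎)
  where open ≡-Reasoning

module Metacyclic
  {D N : Pred Perm∞ 0ℓ} (D-sub : IsSubgroup D) (N-sub : IsSubgroup N)
  (N-normal : ∀ d n → D d → N n → N (d ∙ n ∙ d ⁻¹))
  (g : Perm∞) (g∈N : N g) (N⊆⟨g⟩ : ∀ σ → N σ → ∃[ k ] σ ≈ g ^ k)
  (h : Perm∞) (h∈D : D h) (D⊆⟨h⟩N : ∀ d → D d → ∃[ k ] N ((h ^ k) ⁻¹ ∙ d))
  where
  open IsSubgroup

  module Order-g = PowerIndex ≈idP-isSubgroup (_≈? idP) g

  r : ℕ
  r = Order-g.index

  log-exists : N π → ∃ λ k → k < r × π ≈ g ^ⁿ k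
  log-exists {π} π∈N with N⊆⟨g⟩ π π∈N
  ... | z , π≈gᶻ with ^-as-^ⁿ g z
  ...   | m , gᶻ≈gᵐ = m % r , m%n<n m r , (begin
    π               ≈⟨ π≈gᶻ ⟩
    g ^ z           ≈⟨ gᶻ≈gᵐ ⟩
    g ^ⁿ m          ≈⟨ ⁻¹∙≈idP⇒≈ {g ^ⁿ (m % r)} {g ^ⁿ m} (Order-g.^ⁿ-%index m) ⟨
    g ^ⁿ (m % r)    ∎)
    where open ≈-Reasoning

  opaque
    log : Perm∞ → ℕ
    log π = firstBelow (λ k → π ≈? g ^ⁿ k) r

    log-spec : N π → log π < r × π ≈ g ^ⁿ log π
    log-spec {π} π∈N = let k , k<r , π≈gᵏ = log-exists π∈N in firstBelow-spec (λ k → π ≈? g ^ⁿ k) k<r π≈gᵏ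

  log-injective : N π → N π′ → log π ≡ log π′ → π ≈ π′
  log-injective {π} {π′} π∈N π′∈N eq i =
    trans (proj₂ (log-spec π∈N) i) (trans (cong (λ k → fun (g ^ⁿ k) i) eq) (sym (proj₂ (log-spec π′∈N) i)))

  r∣E*log : ∀ E → N π → π ^ⁿ E ≈ idP → r ∣ E * log π
  r∣E*log {π} E π∈N πᴱ≈idP = Order-g.index-∣ (begin
    g ^ⁿ (E * log π)    ≈⟨ ^ⁿ-* g E (log π) ⟩
    (g ^ⁿ log π) ^ⁿ E   ≈⟨ ^ⁿ-cong (proj₂ (log-spec π∈N)) E ⟨
    π ^ⁿ E              ≈⟨ πᴱ≈idP ⟩
    idP                 ∎)
    where open ≈-Reasoning

  N? : Decidable N
  N? π = map′ (λ π≈gᵏ → resp N-sub (λ i → sym (π≈gᵏ i)) (^ⁿ-closed N-sub g∈N (log π))) (proj₂ ∘ log-spec)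
              (π ≈? g ^ⁿ log π)

  module Order-hN = PowerIndex N-sub N? h

  q : ℕ
  q = Order-hN.index

  cosetIndex-exists : D σ → ∃ λ α → α < q × N ((h ^ⁿ α) ⁻¹ ∙ σ)
  cosetIndex-exists {σ} σ∈D with D⊆⟨h⟩N σ σ∈D
  ... | z , hᶻ~σ with ^-as-^ⁿ h z
  ...   | a , hᶻ≈hᵃ = a % q , m%n<n a q ,
    coset-trans N-sub {h ^ⁿ (a % q)} {h ^ⁿ a} {σ} (Order-hN.^ⁿ-%index a)
      (resp N-sub (∙-cong {(h ^ z) ⁻¹} {(h ^ⁿ a) ⁻¹} {σ} {σ} (⁻¹-cong {h ^ z} {h ^ⁿ a} hᶻ≈hᵃ) (λ _ → refl)) hᶻ~σ)

  opaque
    cosetIndex : Perm∞ → ℕ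
    cosetIndex σ = firstBelow (λ α → N? ((h ^ⁿ α) ⁻¹ ∙ σ)) q

    cosetIndex-spec : D σ → cosetIndex σ < q × N ((h ^ⁿ cosetIndex σ) ⁻¹ ∙ σ)
    cosetIndex-spec {σ} σ∈D =
      let α , α<q , hᵅ~σ = cosetIndex-exists σ∈D in firstBelow-spec (λ α → N? ((h ^ⁿ α) ⁻¹ ∙ σ)) α<q hᵅ~σ

  -- x⁻⁽ᵐ⁺¹⁾σᵐ⁺¹ = (x⁻ᵐ (x⁻¹σ) xᵐ) (x⁻ᵐσᵐ): a conjugate of x⁻¹σ times the previous case.
  coset-^ⁿ : D x → D σ → N (x ⁻¹ ∙ σ) → ∀ m → N ((x ^ⁿ m) ⁻¹ ∙ σ ^ⁿ m)
  coset-^ⁿ x∈D σ∈D x~σ zero = resp N-sub (λ _ → refl) (has-id N-sub)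
  coset-^ⁿ {x} {σ} x∈D σ∈D x~σ (suc m) = resp N-sub cancel (∙-closed N-sub conjugate (coset-^ⁿ x∈D σ∈D x~σ m))
    where
    xᵐ : Perm∞
    xᵐ = x ^ⁿ m
    conjugate : N (xᵐ ⁻¹ ∙ (x ⁻¹ ∙ σ) ∙ (xᵐ ⁻¹) ⁻¹)
    conjugate = N-normal (xᵐ ⁻¹) (x ⁻¹ ∙ σ) (⁻¹-closed D-sub (^ⁿ-closed D-sub x∈D m)) x~σ
    cancel : xᵐ ⁻¹ ∙ (x ⁻¹ ∙ σ) ∙ (xᵐ ⁻¹) ⁻¹ ∙ (xᵐ ⁻¹ ∙ σ ^ⁿ m) ≈ (x ^ⁿ suc m) ⁻¹ ∙ σ ^ⁿ suc m
    cancel i = cong (λ y → inv xᵐ (inv x (fun σ y))) (fun-inv xᵐ _)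

  module Bound (M K : ℕ) {{_ : NonZero M}} {{_ : NonZero K}} {E : Pred Perm∞ 0ℓ}
               (E-exponent : ∀ {σ} → E σ → σ ^ⁿ M ≈ idP)
               (E-quotient-exponent : ∀ {σ τ} → E σ → E τ → (σ ⁻¹ ∙ τ) ^ⁿ K ≈ idP) where

    q∣M*cosetIndex : D σ → E σ → q ∣ M * cosetIndex σ
    q∣M*cosetIndex {σ} σ∈D σ∈E = Order-hN.index-∣
      (resp N-sub (λ i → sym (^ⁿ-* h M α i)) (⁻¹-closed N-sub hᵅᴹ⁻¹∈N))
      where
      α : ℕ
      α = cosetIndex σ
      hᵅ : Perm∞
      hᵅ = h ^ⁿ α
      hᵅᴹ⁻¹∈N : N ((hᵅ ^ⁿ M) ⁻¹)
      hᵅᴹ⁻¹∈N = resp N-sub (λ i → cong (inv (hᵅ ^ⁿ M)) (E-exponent σ∈E i))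
                 (coset-^ⁿ (^ⁿ-closed D-sub h∈D α) σ∈D (proj₂ (cosetIndex-spec σ∈D)) M)

    cosetCode : Perm∞ → ℕ
    cosetCode σ = M * cosetIndex σ / q

    cosetCode-< : D σ → cosetCode σ < M
    cosetCode-< σ∈D = *-/-< M (proj₁ (cosetIndex-spec σ∈D))

    cosetCode-≡⇒coset : (D ∩ E) σ → (D ∩ E) τ → cosetCode σ ≡ cosetCode τ → N (σ ⁻¹ ∙ τ)
    cosetCode-≡⇒coset {σ} {τ} (σ∈D , σ∈E) (τ∈D , τ∈E) eq =
      coset-trans N-sub {σ} {h ^ⁿ cosetIndex σ} {τ} (coset-sym N-sub {h ^ⁿ cosetIndex σ} {σ} (proj₂ (cosetIndex-spec σ∈D)))
        (subst (λ α → N ((h ^ⁿ α) ⁻¹ ∙ τ)) (sym α≡) (proj₂ (cosetIndex-spec τ∈D)))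
      where
      α≡ : cosetIndex σ ≡ cosetIndex τ
      α≡ = *-/-injective M (q∣M*cosetIndex σ∈D σ∈E) (q∣M*cosetIndex τ∈D τ∈E) eq

    -- The elements of a coset σ₁N are told apart by the discrete logarithm of σ₁⁻¹τ to base g.
    fibre-length : ∀ {t zs} → All (D ∩ E) zs → AllPairs _≉_ zs → All (λ z → cosetCode z ≡ t) zs → length zs ≤ K
    fibre-length {zs = []}     _                 _        _              = z≤n
    fibre-length {t} {zs@(σ₁ ∷ _)} zs∈D∩E@(σ₁∈D∩E ∷ _) distinct codes@(σ₁≡t ∷ _) =
      length-≤-code relativeCode (All.map relativeCode-< members) (AllPairs-mapWith relativeCode-injective members distinct)
      where
      Member : Pred Perm∞ 0ℓ
      Member τ = (D ∩ E) τ × cosetCode τ ≡ t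
      members : All Member zs
      members = All.zip (zs∈D∩E , codes)
      σ₁~ : Member τ → N (σ₁ ⁻¹ ∙ τ)
      σ₁~ (τ∈D∩E , τ≡t) = cosetCode-≡⇒coset σ₁∈D∩E τ∈D∩E (trans σ₁≡t (sym τ≡t))
      relativeCode : Perm∞ → ℕ
      relativeCode τ = K * log (σ₁ ⁻¹ ∙ τ) / r
      relativeCode-< : Member τ → relativeCode τ < K
      relativeCode-< m = *-/-< K (proj₁ (log-spec (σ₁~ m)))
      r∣ : Member τ → r ∣ K * log (σ₁ ⁻¹ ∙ τ)
      r∣ m = r∣E*log K (σ₁~ m) (E-quotient-exponent (proj₂ σ₁∈D∩E) (proj₂ (proj₁ m)))
      relativeCode-injective : Member τ → Member ρ → τ ≉ ρ → relativeCode τ ≢ relativeCode ρ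
      relativeCode-injective {τ} {ρ} m m′ τ≉ρ eq = τ≉ρ (∙-cancelˡ {σ₁ ⁻¹} {τ} {ρ}
        (log-injective (σ₁~ m) (σ₁~ m′) (*-/-injective K (r∣ m) (r∣ m′) eq)))

    length-≤ : ∀ {xs} → All D xs → All E xs → AllPairs _≉_ xs → length xs ≤ M * K
    length-≤ xs∈D xs∈E distinct =
      length-≤-fibres cosetCode fibre-length M (All.zip (xs∈D , xs∈E)) distinct (All.map cosetCode-< xs∈D)


mainTheorem12 : (σ₀ : Perm∞) → ∃[ b ] ((D : Pred Perm∞ 0ℓ) → IsSubgroup D → IsMetacyclic D →
    (xs : List Perm∞) → All D xs → All (λ σ → cycleStructure σ ≡ cycleStructure σ₀) xs →
    AllPairs (λ σ τ → ¬ (σ ≈ τ)) xs → length xs ≤ b)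
mainTheorem12 σ₀ = s ! * (s + s) ! , λ
  { D D-sub (N , (N-sub , _ , N-normal) , (g , g∈N , N⊆⟨g⟩) , (h , h∈D , D⊆⟨h⟩N)) xs xs∈D xs∈X distinct →
      Metacyclic.Bound.length-≤ D-sub N-sub N-normal g g∈N N⊆⟨g⟩ h h∈D D⊆⟨h⟩N (s !) ((s + s) !)
        {{s !≢0}} {{(s + s) !≢0}}
        (λ {σ} σ∈X → ^ⁿ-!≈idP-support {σ} (support≤s {σ} σ∈X))
        (λ {σ} {τ} σ∈X τ∈X → ⁻¹∙-^ⁿ-!≈idP-support {σ} {τ} (support≤s {σ} σ∈X) (support≤s {τ} τ∈X))
        xs∈D xs∈X distinct }
  where
  s : ℕ
  s = 2 * sum (cycleStructure σ₀)
  support≤s : ∀ {σ} → cycleStructure σ ≡ cycleStructure σ₀ → length (support σ) ≤ s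
  support≤s {σ} eq = subst (λ c → length (support σ) ≤ 2 * sum c) eq (length-support σ)
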